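{- Let $\Sigma \subset \mathbb{N} = \{1,2,3,\dots\}$ be an alphabet of positive integers and let $w \in \Sigma^+$ be a primitive word. Then the polynomial $P_w(X)$ is not divisible in $\mathbb{Q}[X]$ by any polynomial of the form $(X^{|w|}-1)/(X^{d}-1)$, where $d < |w|$ is a positive divisor of $|w|$.
   Context: For a word $w = a_0 a_1 \cdots a_{n-1} \in \Sigma^n$ (letters $a_i \in \Sigma$ are positive integers), $P_w(X) = a_0 + a_1 X + \dots + a_{n-1}X^{n-1} \in \mathbb{Z}[X]$. A nonempty word $w$ is primitive if it is not of the form $u^k$ for any word $u$ and integer $k > 1$. $|w|$ denotes the length of $w$. -}

module Defs where

open import Data.Nat using (ℕ; zero; suc; _≤_; _<_)
open import Data.Integer using (+_)
open import Data.Rational using (ℚ; 0ℚ; 1ℚ; -_; _+_; _*_; _/_)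
open import Data.List using (List; []; _∷_; map; concat; replicate; length)
open import Data.List.Relation.Unary.All using (All)
open import Data.Product using (Σ; ∃; _×_; _,_)
open import Relation.Binary.PropositionalEquality using (_≡_)
open import Relation.Nullary using (¬_)

Word : Set
Word = List ℕ

PositiveLetters : Word → Set
PositiveLetters w = All (λ a → 1 ≤ a) w

_^ʷ_ : Word → ℕ → Word
u ^ʷ k = concat (replicate k u)

Primitive : Word → Set
Primitive w = ¬ (w ≡ []) × ¬ (Σ Word λ u → Σ ℕ λ k → (1 < k) × (w ≡ u ^ʷ k))

-- Polynomials in ℚ[X] as coefficient lists a₀ ∷ a₁ ∷ … (lowest degree first)

Poly : Set
Poly = List ℚ

coeff : Poly → ℕ → ℚ
coeff []       i       = 0ℚ
coeff (a ∷ p)  zero    = a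
coeff (a ∷ p)  (suc i) = coeff p i

-- equality of polynomials (coefficientwise, so trailing zeros are irrelevant)
_≈ₚ_ : Poly → Poly → Set
p ≈ₚ q = ∀ i → coeff p i ≡ coeff q i

_+ₚ_ : Poly → Poly → Poly
[]      +ₚ q       = q
(a ∷ p) +ₚ []      = a ∷ p
(a ∷ p) +ₚ (b ∷ q) = (a + b) ∷ (p +ₚ q)

scaleₚ : ℚ → Poly → Poly
scaleₚ c p = map (c *_) p

_*ₚ_ : Poly → Poly → Poly
[]      *ₚ q = []
(a ∷ p) *ₚ q = scaleₚ a q +ₚ (0ℚ ∷ (p *ₚ q))

_∣ₚ_ : Poly → Poly → Set
g ∣ₚ f = Σ Poly λ q → f ≈ₚ (g *ₚ q)

Xpow : ℕ → Poly
Xpow zero    = 1ℚ ∷ []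
Xpow (suc n) = 0ℚ ∷ Xpow n

XpowMinus1 : ℕ → Poly
XpowMinus1 n = Xpow n +ₚ ((- 1ℚ) ∷ [])

-- P_w(X) = a₀ + a₁ X + … + a_{n-1} X^{n-1}
Pw : Word → Poly
Pw w = map (λ a → + a / 1) w

module Submission where

open import Defs
open import Data.Nat using (ℕ; _<_)
open import Data.Nat.Divisibility using (_∣_)
open import Data.List using (length)
open import Relation.Nullary using (¬_)

open import Data.Nat using (zero; suc; _≤_; z≤n; s≤s; _∸_; >-nonZero)
  renaming (_+_ to _+ℕ_; _*_ to _*ℕ_)
import Data.Nat.Properties as ℕₚ
open import Data.Nat.Divisibility using (divides)
open import Data.List using ([]; _∷_; take; drop; _++_)
import Data.List.Properties as Listₚ
import Data.Integer as ℤ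
import Data.Integer.Properties as ℤₚ
open import Data.Rational using (0ℚ; 1ℚ; -_; _+_; _-_; _*_; _/_)
open import Data.Rational.Unnormalised using (mkℚᵘ; *≡*)
import Data.Rational.Properties as ℚₚ
open import Data.Rational.Solver using (module +-*-Solver)
open +-*-Solver using (solve; _:+_; _:*_; _:=_)
open import Data.Product using (_,_)
open import Algebra.Properties.Group ℚₚ.+-0-group using (x∙y⁻¹≈ε⇒x≈y)
open import Algebra.Properties.CommutativeSemigroup ℕₚ.+-commutativeSemigroup using (x∙yz≈y∙xz)
open import Relation.Nullary using (contradiction)
open import Relation.Binary.PropositionalEquality
open ≡-Reasoning

-- If (Xⁿ − 1)/(Xᵈ − 1) divided P_w, then (Xᵈ − 1) P_w = (Xⁿ − 1) q for some q. Comparing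
-- coefficients above degree n (where P_w vanishes) shows that the coefficients of q from
-- degree d on repeat with period n, so they vanish since q is a polynomial; comparing the
-- coefficients below degree n then shows that the coefficients of P_w repeat with period d.
-- Hence w = u^(n/d) for its prefix u of length d, so w is not primitive.

coeff-+ₚ : ∀ p q i → coeff (p +ₚ q) i ≡ coeff p i + coeff q i
coeff-+ₚ []      q       i       = sym (ℚₚ.+-identityˡ _)
coeff-+ₚ (a ∷ p) []      i       = sym (ℚₚ.+-identityʳ _)
coeff-+ₚ (a ∷ p) (b ∷ q) zero    = refl
coeff-+ₚ (a ∷ p) (b ∷ q) (suc i) = coeff-+ₚ p q i

coeff-scaleₚ : ∀ c p i → coeff (scaleₚ c p) i ≡ c * coeff p i
coeff-scaleₚ c []      i       = sym (ℚₚ.*-zeroʳ c)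
coeff-scaleₚ c (a ∷ p) zero    = refl
coeff-scaleₚ c (a ∷ p) (suc i) = coeff-scaleₚ c p i

coeff-≥-length : ∀ p {i} → length p ≤ i → coeff p i ≡ 0ℚ
coeff-≥-length []      _           = refl
coeff-≥-length (a ∷ p) (s≤s |p|≤i) = coeff-≥-length p |p|≤i

-- (a ∷ p) *ₚ q unfolds to scaleₚ a q +ₚ (0ℚ ∷ p *ₚ q), i.e. a·q + X·(p·q).
coeff-scale+shift-zero : ∀ b p s → coeff (scaleₚ b p +ₚ (0ℚ ∷ s)) 0 ≡ b * coeff p 0
coeff-scale+shift-zero b p s = begin
  coeff (scaleₚ b p +ₚ (0ℚ ∷ s)) 0 ≡⟨ coeff-+ₚ (scaleₚ b p) (0ℚ ∷ s) 0 ⟩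
  coeff (scaleₚ b p) 0 + 0ℚ        ≡⟨ ℚₚ.+-identityʳ _ ⟩
  coeff (scaleₚ b p) 0             ≡⟨ coeff-scaleₚ b p 0 ⟩
  b * coeff p 0                    ∎

coeff-scale+shift-suc : ∀ b p s i →
  coeff (scaleₚ b p +ₚ (0ℚ ∷ s)) (suc i) ≡ b * coeff p (suc i) + coeff s i
coeff-scale+shift-suc b p s i = begin
  coeff (scaleₚ b p +ₚ (0ℚ ∷ s)) (suc i)   ≡⟨ coeff-+ₚ (scaleₚ b p) (0ℚ ∷ s) (suc i) ⟩
  coeff (scaleₚ b p) (suc i) + coeff s i   ≡⟨ cong (_+ coeff s i) (coeff-scaleₚ b p (suc i)) ⟩
  b * coeff p (suc i) + coeff s i          ∎

+ₚ-cong : ∀ {p p′ q q′} → p ≈ₚ p′ → q ≈ₚ q′ → (p +ₚ q) ≈ₚ (p′ +ₚ q′)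
+ₚ-cong {p} {p′} {q} {q′} p≈p′ q≈q′ i = begin
  coeff (p +ₚ q) i        ≡⟨ coeff-+ₚ p q i ⟩
  coeff p i + coeff q i   ≡⟨ cong₂ _+_ (p≈p′ i) (q≈q′ i) ⟩
  coeff p′ i + coeff q′ i ≡⟨ coeff-+ₚ p′ q′ i ⟨
  coeff (p′ +ₚ q′) i      ∎

+ₚ-identityʳ : ∀ p → (p +ₚ []) ≈ₚ p
+ₚ-identityʳ []      i = refl
+ₚ-identityʳ (a ∷ p) i = refl

∷-cong : ∀ {a b p q} → a ≡ b → p ≈ₚ q → (a ∷ p) ≈ₚ (b ∷ q)
∷-cong a≡b p≈q zero    = a≡b
∷-cong a≡b p≈q (suc i) = p≈q i

*ₚ-congˡ : ∀ p {q r} → q ≈ₚ r → (p *ₚ q) ≈ₚ (p *ₚ r)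
*ₚ-congˡ []      q≈r i = refl
*ₚ-congˡ (a ∷ p) {q} {r} q≈r zero = begin
  coeff ((a ∷ p) *ₚ q) 0 ≡⟨ coeff-scale+shift-zero a q (p *ₚ q) ⟩
  a * coeff q 0          ≡⟨ cong (a *_) (q≈r 0) ⟩
  a * coeff r 0          ≡⟨ coeff-scale+shift-zero a r (p *ₚ r) ⟨
  coeff ((a ∷ p) *ₚ r) 0 ∎
*ₚ-congˡ (a ∷ p) {q} {r} q≈r (suc i) = begin
  coeff ((a ∷ p) *ₚ q) (suc i)               ≡⟨ coeff-scale+shift-suc a q (p *ₚ q) i ⟩
  a * coeff q (suc i) + coeff (p *ₚ q) i     ≡⟨ cong₂ _+_ (cong (a *_) (q≈r (suc i))) (*ₚ-congˡ p q≈r i) ⟩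
  a * coeff r (suc i) + coeff (p *ₚ r) i     ≡⟨ coeff-scale+shift-suc a r (p *ₚ r) i ⟨
  coeff ((a ∷ p) *ₚ r) (suc i)               ∎

*ₚ-zeroˡ : ∀ p q → p ≈ₚ [] → (p *ₚ q) ≈ₚ []
*ₚ-zeroˡ []      q p≈0 i       = refl
*ₚ-zeroˡ (a ∷ p) q p≈0 zero    = begin
  coeff ((a ∷ p) *ₚ q) 0  ≡⟨ coeff-scale+shift-zero a q (p *ₚ q) ⟩
  a * coeff q 0           ≡⟨ cong (_* coeff q 0) (p≈0 0) ⟩
  0ℚ * coeff q 0          ≡⟨ ℚₚ.*-zeroˡ (coeff q 0) ⟩
  0ℚ                      ∎
*ₚ-zeroˡ (a ∷ p) q p≈0 (suc i) = begin
  coeff ((a ∷ p) *ₚ q) (suc i)            ≡⟨ coeff-scale+shift-suc a q (p *ₚ q) i ⟩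
  a * coeff q (suc i) + coeff (p *ₚ q) i  ≡⟨ cong₂ _+_ (cong (_* coeff q (suc i)) (p≈0 0))
                                                      (*ₚ-zeroˡ p q (λ j → p≈0 (suc j)) i) ⟩
  0ℚ * coeff q (suc i) + 0ℚ               ≡⟨ ℚₚ.+-identityʳ _ ⟩
  0ℚ * coeff q (suc i)                    ≡⟨ ℚₚ.*-zeroˡ (coeff q (suc i)) ⟩
  0ℚ                                      ∎

*ₚ-zeroʳ : ∀ p → (p *ₚ []) ≈ₚ []
*ₚ-zeroʳ []      i       = refl
*ₚ-zeroʳ (a ∷ p) zero    = refl
*ₚ-zeroʳ (a ∷ p) (suc i) = *ₚ-zeroʳ p i

*ₚ-congʳ : ∀ {p p′} q → p ≈ₚ p′ → (p *ₚ q) ≈ₚ (p′ *ₚ q)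
*ₚ-congʳ {[]}    {[]}     q p≈p′ i = refl
*ₚ-congʳ {[]}    {a ∷ p′} q p≈p′ i = sym (*ₚ-zeroˡ (a ∷ p′) q (λ j → sym (p≈p′ j)) i)
*ₚ-congʳ {a ∷ p} {[]}     q p≈p′   = *ₚ-zeroˡ (a ∷ p) q p≈p′
*ₚ-congʳ {a ∷ p} {b ∷ p′} q p≈p′ zero = begin
  coeff ((a ∷ p) *ₚ q) 0  ≡⟨ coeff-scale+shift-zero a q (p *ₚ q) ⟩
  a * coeff q 0           ≡⟨ cong (_* coeff q 0) (p≈p′ 0) ⟩
  b * coeff q 0           ≡⟨ coeff-scale+shift-zero b q (p′ *ₚ q) ⟨
  coeff ((b ∷ p′) *ₚ q) 0 ∎
*ₚ-congʳ {a ∷ p} {b ∷ p′} q p≈p′ (suc i) = begin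
  coeff ((a ∷ p) *ₚ q) (suc i)             ≡⟨ coeff-scale+shift-suc a q (p *ₚ q) i ⟩
  a * coeff q (suc i) + coeff (p *ₚ q) i   ≡⟨ cong₂ _+_ (cong (_* coeff q (suc i)) (p≈p′ 0))
                                                       (*ₚ-congʳ {p} {p′} q (λ j → p≈p′ (suc j)) i) ⟩
  b * coeff q (suc i) + coeff (p′ *ₚ q) i  ≡⟨ coeff-scale+shift-suc b q (p′ *ₚ q) i ⟨
  coeff ((b ∷ p′) *ₚ q) (suc i)            ∎

*ₚ-∷ : ∀ p b q → (p *ₚ (b ∷ q)) ≈ₚ (scaleₚ b p +ₚ (0ℚ ∷ p *ₚ q))
*ₚ-∷ []      b q zero    = refl
*ₚ-∷ []      b q (suc i) = refl
*ₚ-∷ (a ∷ p) b q zero    = begin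
  coeff ((a ∷ p) *ₚ (b ∷ q)) 0                        ≡⟨ coeff-scale+shift-zero a (b ∷ q) (p *ₚ (b ∷ q)) ⟩
  a * b                                               ≡⟨ ℚₚ.*-comm a b ⟩
  b * a                                               ≡⟨ coeff-scale+shift-zero b (a ∷ p) ((a ∷ p) *ₚ q) ⟨
  coeff (scaleₚ b (a ∷ p) +ₚ (0ℚ ∷ (a ∷ p) *ₚ q)) 0  ∎
*ₚ-∷ (a ∷ p) b q (suc i) = begin
  coeff ((a ∷ p) *ₚ (b ∷ q)) (suc i)                         ≡⟨ coeff-scale+shift-suc a (b ∷ q) _ i ⟩
  a * coeff q i + coeff (p *ₚ (b ∷ q)) i                     ≡⟨ cong (a * coeff q i +_) (*ₚ-∷ p b q i) ⟩
  a * coeff q i + coeff (scaleₚ b p +ₚ (0ℚ ∷ p *ₚ q)) i      ≡⟨ swap i ⟩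
  b * coeff p i + coeff ((a ∷ p) *ₚ q) i                     ≡⟨ coeff-scale+shift-suc b (a ∷ p) _ i ⟨
  coeff (scaleₚ b (a ∷ p) +ₚ (0ℚ ∷ (a ∷ p) *ₚ q)) (suc i)    ∎
  where
  swap : ∀ i → a * coeff q i + coeff (scaleₚ b p +ₚ (0ℚ ∷ p *ₚ q)) i
             ≡ b * coeff p i + coeff ((a ∷ p) *ₚ q) i
  swap zero = begin
    a * coeff q 0 + coeff (scaleₚ b p +ₚ (0ℚ ∷ p *ₚ q)) 0
      ≡⟨ cong (a * coeff q 0 +_) (coeff-scale+shift-zero b p _) ⟩
    a * coeff q 0 + b * coeff p 0
      ≡⟨ ℚₚ.+-comm (a * coeff q 0) (b * coeff p 0) ⟩
    b * coeff p 0 + a * coeff q 0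
      ≡⟨ cong (b * coeff p 0 +_) (coeff-scale+shift-zero a q _) ⟨
    b * coeff p 0 + coeff ((a ∷ p) *ₚ q) 0 ∎
  swap (suc j) = begin
    a * coeff q (suc j) + coeff (scaleₚ b p +ₚ (0ℚ ∷ p *ₚ q)) (suc j)
      ≡⟨ cong (a * coeff q (suc j) +_) (coeff-scale+shift-suc b p _ j) ⟩
    a * coeff q (suc j) + (b * coeff p (suc j) + coeff (p *ₚ q) j)
      ≡⟨ solve 3 (λ x y z → x :+ (y :+ z) := y :+ (x :+ z)) refl (a * coeff q (suc j)) (b * coeff p (suc j)) (coeff (p *ₚ q) j) ⟩
    b * coeff p (suc j) + (a * coeff q (suc j) + coeff (p *ₚ q) j)
      ≡⟨ cong (b * coeff p (suc j) +_) (coeff-scale+shift-suc a q _ j) ⟨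
    b * coeff p (suc j) + coeff ((a ∷ p) *ₚ q) (suc j) ∎

*ₚ-comm : ∀ p q → (p *ₚ q) ≈ₚ (q *ₚ p)
*ₚ-comm []      q i = sym (*ₚ-zeroʳ q i)
*ₚ-comm (a ∷ p) q i = begin
  coeff ((a ∷ p) *ₚ q) i                   ≡⟨ +ₚ-cong {scaleₚ a q} {scaleₚ a q} {0ℚ ∷ p *ₚ q} {0ℚ ∷ q *ₚ p}
                                                       (λ _ → refl) (∷-cong refl (*ₚ-comm p q)) i ⟩
  coeff (scaleₚ a q +ₚ (0ℚ ∷ q *ₚ p)) i    ≡⟨ *ₚ-∷ q a p i ⟨
  coeff (q *ₚ (a ∷ p)) i                   ∎

*ₚ-distribʳ-+ₚ : ∀ r s t → ((s +ₚ t) *ₚ r) ≈ₚ ((s *ₚ r) +ₚ (t *ₚ r))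
*ₚ-distribʳ-+ₚ r []      t       i = refl
*ₚ-distribʳ-+ₚ r (a ∷ s) []      i = sym (+ₚ-identityʳ ((a ∷ s) *ₚ r) i)
*ₚ-distribʳ-+ₚ r (a ∷ s) (b ∷ t) zero = begin
  coeff ((a + b ∷ s +ₚ t) *ₚ r) 0                     ≡⟨ coeff-scale+shift-zero (a + b) r _ ⟩
  (a + b) * coeff r 0                                 ≡⟨ ℚₚ.*-distribʳ-+ (coeff r 0) a b ⟩
  a * coeff r 0 + b * coeff r 0                       ≡⟨ cong₂ _+_ (coeff-scale+shift-zero a r _)
                                                                    (coeff-scale+shift-zero b r _) ⟨
  coeff ((a ∷ s) *ₚ r) 0 + coeff ((b ∷ t) *ₚ r) 0     ≡⟨ coeff-+ₚ ((a ∷ s) *ₚ r) ((b ∷ t) *ₚ r) 0 ⟨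
  coeff (((a ∷ s) *ₚ r) +ₚ ((b ∷ t) *ₚ r)) 0          ∎
*ₚ-distribʳ-+ₚ r (a ∷ s) (b ∷ t) (suc i) = begin
  coeff ((a + b ∷ s +ₚ t) *ₚ r) (suc i)
    ≡⟨ coeff-scale+shift-suc (a + b) r _ i ⟩
  (a + b) * coeff r (suc i) + coeff ((s +ₚ t) *ₚ r) i
    ≡⟨ cong ((a + b) * coeff r (suc i) +_) (*ₚ-distribʳ-+ₚ r s t i) ⟩
  (a + b) * coeff r (suc i) + coeff ((s *ₚ r) +ₚ (t *ₚ r)) i
    ≡⟨ cong ((a + b) * coeff r (suc i) +_) (coeff-+ₚ (s *ₚ r) (t *ₚ r) i) ⟩
  (a + b) * coeff r (suc i) + (coeff (s *ₚ r) i + coeff (t *ₚ r) i)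
    ≡⟨ solve 5 (λ a b x y z → (a :+ b) :* x :+ (y :+ z) := (a :* x :+ y) :+ (b :* x :+ z))
             refl a b (coeff r (suc i)) (coeff (s *ₚ r) i) (coeff (t *ₚ r) i) ⟩
  (a * coeff r (suc i) + coeff (s *ₚ r) i) + (b * coeff r (suc i) + coeff (t *ₚ r) i)
    ≡⟨ cong₂ _+_ (coeff-scale+shift-suc a r _ i) (coeff-scale+shift-suc b r _ i) ⟨
  coeff ((a ∷ s) *ₚ r) (suc i) + coeff ((b ∷ t) *ₚ r) (suc i)
    ≡⟨ coeff-+ₚ ((a ∷ s) *ₚ r) ((b ∷ t) *ₚ r) (suc i) ⟨
  coeff (((a ∷ s) *ₚ r) +ₚ ((b ∷ t) *ₚ r)) (suc i) ∎

scaleₚ-*ₚ : ∀ a q r → (scaleₚ a q *ₚ r) ≈ₚ scaleₚ a (q *ₚ r)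
scaleₚ-*ₚ a []      r i    = refl
scaleₚ-*ₚ a (b ∷ q) r zero = begin
  coeff ((a * b ∷ scaleₚ a q) *ₚ r) 0 ≡⟨ coeff-scale+shift-zero (a * b) r _ ⟩
  a * b * coeff r 0                   ≡⟨ ℚₚ.*-assoc a b (coeff r 0) ⟩
  a * (b * coeff r 0)                 ≡⟨ cong (a *_) (coeff-scale+shift-zero b r _) ⟨
  a * coeff ((b ∷ q) *ₚ r) 0          ≡⟨ coeff-scaleₚ a ((b ∷ q) *ₚ r) 0 ⟨
  coeff (scaleₚ a ((b ∷ q) *ₚ r)) 0   ∎
scaleₚ-*ₚ a (b ∷ q) r (suc i) = begin
  coeff ((a * b ∷ scaleₚ a q) *ₚ r) (suc i)
    ≡⟨ coeff-scale+shift-suc (a * b) r _ i ⟩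
  a * b * coeff r (suc i) + coeff (scaleₚ a q *ₚ r) i
    ≡⟨ cong (a * b * coeff r (suc i) +_) (trans (scaleₚ-*ₚ a q r i) (coeff-scaleₚ a (q *ₚ r) i)) ⟩
  a * b * coeff r (suc i) + a * coeff (q *ₚ r) i
    ≡⟨ solve 4 (λ a b x y → a :* b :* x :+ a :* y := a :* (b :* x :+ y)) refl a b (coeff r (suc i)) (coeff (q *ₚ r) i) ⟩
  a * (b * coeff r (suc i) + coeff (q *ₚ r) i)
    ≡⟨ cong (a *_) (coeff-scale+shift-suc b r _ i) ⟨
  a * coeff ((b ∷ q) *ₚ r) (suc i)
    ≡⟨ coeff-scaleₚ a ((b ∷ q) *ₚ r) (suc i) ⟨
  coeff (scaleₚ a ((b ∷ q) *ₚ r)) (suc i) ∎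

0∷-*ₚ : ∀ p r → ((0ℚ ∷ p) *ₚ r) ≈ₚ (0ℚ ∷ p *ₚ r)
0∷-*ₚ p r zero    = trans (coeff-scale+shift-zero 0ℚ r _) (ℚₚ.*-zeroˡ (coeff r 0))
0∷-*ₚ p r (suc i) = begin
  coeff ((0ℚ ∷ p) *ₚ r) (suc i)           ≡⟨ coeff-scale+shift-suc 0ℚ r _ i ⟩
  0ℚ * coeff r (suc i) + coeff (p *ₚ r) i ≡⟨ cong (_+ coeff (p *ₚ r) i) (ℚₚ.*-zeroˡ (coeff r (suc i))) ⟩
  0ℚ + coeff (p *ₚ r) i                   ≡⟨ ℚₚ.+-identityˡ _ ⟩
  coeff (p *ₚ r) i                        ∎

*ₚ-assoc : ∀ p q r → ((p *ₚ q) *ₚ r) ≈ₚ (p *ₚ (q *ₚ r))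
*ₚ-assoc []      q r i = refl
*ₚ-assoc (a ∷ p) q r i = begin
  coeff ((scaleₚ a q +ₚ (0ℚ ∷ p *ₚ q)) *ₚ r) i
    ≡⟨ *ₚ-distribʳ-+ₚ r (scaleₚ a q) (0ℚ ∷ p *ₚ q) i ⟩
  coeff ((scaleₚ a q *ₚ r) +ₚ ((0ℚ ∷ p *ₚ q) *ₚ r)) i
    ≡⟨ +ₚ-cong {scaleₚ a q *ₚ r} {scaleₚ a (q *ₚ r)} {(0ℚ ∷ p *ₚ q) *ₚ r} {0ℚ ∷ (p *ₚ q) *ₚ r}
               (scaleₚ-*ₚ a q r) (0∷-*ₚ (p *ₚ q) r) i ⟩
  coeff (scaleₚ a (q *ₚ r) +ₚ (0ℚ ∷ (p *ₚ q) *ₚ r)) i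
    ≡⟨ +ₚ-cong {scaleₚ a (q *ₚ r)} {scaleₚ a (q *ₚ r)} {0ℚ ∷ (p *ₚ q) *ₚ r} {0ℚ ∷ p *ₚ (q *ₚ r)}
               (λ _ → refl) (∷-cong refl (*ₚ-assoc p q r)) i ⟩
  coeff (scaleₚ a (q *ₚ r) +ₚ (0ℚ ∷ p *ₚ (q *ₚ r))) i ∎

coeff-Xpow-*ₚ-+ : ∀ m p k → coeff (Xpow m *ₚ p) (m +ℕ k) ≡ coeff p k
coeff-Xpow-*ₚ-+ zero    p zero    = trans (coeff-scale+shift-zero 1ℚ p []) (ℚₚ.*-identityˡ _)
coeff-Xpow-*ₚ-+ zero    p (suc k) = begin
  coeff (Xpow 0 *ₚ p) (suc k) ≡⟨ coeff-scale+shift-suc 1ℚ p [] k ⟩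
  1ℚ * coeff p (suc k) + 0ℚ   ≡⟨ ℚₚ.+-identityʳ _ ⟩
  1ℚ * coeff p (suc k)        ≡⟨ ℚₚ.*-identityˡ _ ⟩
  coeff p (suc k)             ∎
coeff-Xpow-*ₚ-+ (suc m) p k = trans (0∷-*ₚ (Xpow m) p (suc (m +ℕ k))) (coeff-Xpow-*ₚ-+ m p k)

coeff-Xpow-*ₚ-< : ∀ m p {k} → k < m → coeff (Xpow m *ₚ p) k ≡ 0ℚ
coeff-Xpow-*ₚ-< (suc m) p {zero}  _         = 0∷-*ₚ (Xpow m) p 0
coeff-Xpow-*ₚ-< (suc m) p {suc k} (s≤s k<m) =
  trans (0∷-*ₚ (Xpow m) p (suc k)) (coeff-Xpow-*ₚ-< m p k<m)

coeff-XpowMinus1-*ₚ : ∀ m p j → coeff (XpowMinus1 m *ₚ p) j ≡ coeff (Xpow m *ₚ p) j - coeff p j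
coeff-XpowMinus1-*ₚ m p j = begin
  coeff (XpowMinus1 m *ₚ p) j                          ≡⟨ *ₚ-distribʳ-+ₚ p (Xpow m) _ j ⟩
  coeff ((Xpow m *ₚ p) +ₚ ((- 1ℚ ∷ []) *ₚ p)) j        ≡⟨ coeff-+ₚ (Xpow m *ₚ p) _ j ⟩
  coeff (Xpow m *ₚ p) j + coeff ((- 1ℚ ∷ []) *ₚ p) j   ≡⟨ cong (coeff (Xpow m *ₚ p) j +_) (coeff-neg j) ⟩
  coeff (Xpow m *ₚ p) j - coeff p j                    ∎
  where
  -1*≡- : ∀ x → - 1ℚ * x ≡ - x
  -1*≡- x = trans (sym (ℚₚ.neg-distribˡ-* 1ℚ x)) (cong -_ (ℚₚ.*-identityˡ x))

  coeff-neg : ∀ j → coeff ((- 1ℚ ∷ []) *ₚ p) j ≡ - coeff p j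
  coeff-neg zero    = trans (coeff-scale+shift-zero (- 1ℚ) p []) (-1*≡- _)
  coeff-neg (suc j) = begin
    coeff ((- 1ℚ ∷ []) *ₚ p) (suc j) ≡⟨ coeff-scale+shift-suc (- 1ℚ) p [] j ⟩
    - 1ℚ * coeff p (suc j) + 0ℚ      ≡⟨ ℚₚ.+-identityʳ _ ⟩
    - 1ℚ * coeff p (suc j)           ≡⟨ -1*≡- _ ⟩
    - coeff p (suc j)                ∎

module _ {d n : ℕ} {f q : Poly} (|f|≤n : length f ≤ n)
         (eq : (XpowMinus1 d *ₚ f) ≈ₚ (XpowMinus1 n *ₚ q)) where

  private
    coeff-eq : ∀ j → coeff (Xpow d *ₚ f) j - coeff f j ≡ coeff (Xpow n *ₚ q) j - coeff q j
    coeff-eq j = trans (sym (coeff-XpowMinus1-*ₚ d f j)) (trans (eq j) (coeff-XpowMinus1-*ₚ n q j))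

    coeff-f-≥ : ∀ {k} → n ≤ k → coeff f k ≡ 0ℚ
    coeff-f-≥ n≤k = coeff-≥-length f (ℕₚ.≤-trans |f|≤n n≤k)

  cofactor-coeff-periodic : ∀ i → coeff q (d +ℕ i) ≡ coeff q (d +ℕ (n +ℕ i))
  cofactor-coeff-periodic i = x∙y⁻¹≈ε⇒x≈y _ _ (begin
    coeff q (d +ℕ i) - coeff q j                    ≡⟨ cong (_- coeff q j) (coeff-Xpow-*ₚ-+ n q (d +ℕ i)) ⟨
    coeff (Xpow n *ₚ q) (n +ℕ (d +ℕ i)) - coeff q j ≡⟨ cong (λ k → coeff (Xpow n *ₚ q) k - coeff q j) (x∙yz≈y∙xz n d i) ⟩
    coeff (Xpow n *ₚ q) j - coeff q j               ≡⟨ coeff-eq j ⟨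
    coeff (Xpow d *ₚ f) j - coeff f j               ≡⟨ cong₂ _-_ (trans (coeff-Xpow-*ₚ-+ d f (n +ℕ i)) (coeff-f-≥ (ℕₚ.m≤m+n n i)))
                                                                 (coeff-f-≥ (ℕₚ.≤-trans (ℕₚ.m≤m+n n i) (ℕₚ.m≤n+m _ d))) ⟩
    0ℚ - 0ℚ                                         ≡⟨⟩
    0ℚ                                              ∎)
    where j = d +ℕ (n +ℕ i)

  cofactor-coeff-periodic-multiple : ∀ t i → coeff q (d +ℕ i) ≡ coeff q (d +ℕ (t *ℕ n +ℕ i))
  cofactor-coeff-periodic-multiple zero    i = refl
  cofactor-coeff-periodic-multiple (suc t) i = begin
    coeff q (d +ℕ i)                      ≡⟨ cofactor-coeff-periodic-multiple t i ⟩
    coeff q (d +ℕ (t *ℕ n +ℕ i))          ≡⟨ cofactor-coeff-periodic (t *ℕ n +ℕ i) ⟩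
    coeff q (d +ℕ (n +ℕ (t *ℕ n +ℕ i)))   ≡⟨ cong (λ k → coeff q (d +ℕ k)) (ℕₚ.+-assoc n (t *ℕ n) i) ⟨
    coeff q (d +ℕ (suc t *ℕ n +ℕ i))      ∎

  cofactor-coeff-vanish : 0 < n → ∀ i → coeff q (d +ℕ i) ≡ 0ℚ
  cofactor-coeff-vanish 0<n i = trans (cofactor-coeff-periodic-multiple (length q) i) (coeff-≥-length q |q|≤)
    where
    |q|≤ : length q ≤ d +ℕ (length q *ℕ n +ℕ i)
    |q|≤ = ℕₚ.≤-trans (ℕₚ.m≤m*n (length q) n {{>-nonZero 0<n}})
             (ℕₚ.≤-trans (ℕₚ.m≤m+n _ i) (ℕₚ.m≤n+m _ d))

  coeff-periodic : ∀ i → d +ℕ i < n → coeff f i ≡ coeff f (d +ℕ i)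
  coeff-periodic i d+i<n = x∙y⁻¹≈ε⇒x≈y _ _ (begin
    coeff f i - coeff f (d +ℕ i)                       ≡⟨ cong (_- coeff f (d +ℕ i)) (coeff-Xpow-*ₚ-+ d f i) ⟨
    coeff (Xpow d *ₚ f) (d +ℕ i) - coeff f (d +ℕ i)    ≡⟨ coeff-eq (d +ℕ i) ⟩
    coeff (Xpow n *ₚ q) (d +ℕ i) - coeff q (d +ℕ i)    ≡⟨ cong₂ _-_ (coeff-Xpow-*ₚ-< n q d+i<n)
                                                                  (cofactor-coeff-vanish (ℕₚ.<-≤-trans (s≤s z≤n) d+i<n) i) ⟩
    0ℚ - 0ℚ                                            ≡⟨⟩
    0ℚ                                                 ∎)

at : Word → ℕ → ℕ
at []      i       = 0
at (a ∷ w) zero    = a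
at (a ∷ w) (suc i) = at w i

Periodic : ℕ → Word → Set
Periodic d w = ∀ i → d +ℕ i < length w → at w i ≡ at w (d +ℕ i)

at-ext : ∀ u v → length u ≡ length v → (∀ i → i < length u → at u i ≡ at v i) → u ≡ v
at-ext []      []      _       _   = refl
at-ext (a ∷ u) (b ∷ v) |u|≡|v| u≗v =
  cong₂ _∷_ (u≗v 0 (s≤s z≤n)) (at-ext u v (ℕₚ.suc-injective |u|≡|v|) (λ i i<|u| → u≗v (suc i) (s≤s i<|u|)))

at-take : ∀ d w {i} → i < d → at (take d w) i ≡ at w i
at-take (suc d) []              _         = refl
at-take (suc d) (a ∷ w) {zero}  _         = refl
at-take (suc d) (a ∷ w) {suc i} (s≤s i<d) = at-take d w i<d

at-drop : ∀ d w i → at (drop d w) i ≡ at w (d +ℕ i)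
at-drop zero    w       i = refl
at-drop (suc d) []      i = refl
at-drop (suc d) (a ∷ w) i = at-drop d w i

length-take-≤ : ∀ {d} (w : Word) → d ≤ length w → length (take d w) ≡ d
length-take-≤ {d} w d≤|w| = trans (Listₚ.length-take d w) (ℕₚ.m≤n⇒m⊓n≡m d≤|w|)

periodic⇒≡^ʷ : ∀ {d u} k w → length u ≡ d → (∀ i → i < d → i < length w → at u i ≡ at w i) →
               length w ≡ k *ℕ d → Periodic d w → w ≡ u ^ʷ k
periodic⇒≡^ʷ         zero    []  _       _   _        _        = refl
periodic⇒≡^ʷ {d} {u} (suc k) w   |u|≡d   u≗w |w|≡k+1d periodic = begin
  w                        ≡⟨ Listₚ.take++drop≡id d w ⟨
  take d w ++ drop d w     ≡⟨ cong₂ _++_ take≡u (periodic⇒≡^ʷ k (drop d w) |u|≡d u≗drop |drop|≡kd periodic-drop) ⟩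
  u ++ u ^ʷ k              ∎
  where
  d≤|w| : d ≤ length w
  d≤|w| = subst (d ≤_) (sym |w|≡k+1d) (ℕₚ.m≤m+n d (k *ℕ d))
  |drop|≡kd : length (drop d w) ≡ k *ℕ d
  |drop|≡kd = trans (Listₚ.length-drop d w) (trans (cong (_∸ d) |w|≡k+1d) (ℕₚ.m+n∸m≡n d (k *ℕ d)))
  d+<|w| : ∀ {i} → i < length (drop d w) → d +ℕ i < length w
  d+<|w| {i} i<|drop| = subst (d +ℕ i <_) (sym |w|≡k+1d) (ℕₚ.+-monoʳ-< d (subst (i <_) |drop|≡kd i<|drop|))
  take≡u : take d w ≡ u
  take≡u = at-ext (take d w) u (trans (length-take-≤ w d≤|w|) (sym |u|≡d)) λ i i<|take| →
    let i<d = subst (i <_) (length-take-≤ w d≤|w|) i<|take|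
    in trans (at-take d w i<d) (sym (u≗w i i<d (ℕₚ.<-≤-trans i<d d≤|w|)))
  u≗drop : ∀ i → i < d → i < length (drop d w) → at u i ≡ at (drop d w) i
  u≗drop i i<d i<|drop| =
    trans (u≗w i i<d (ℕₚ.<-≤-trans i<d d≤|w|)) (trans (periodic i (d+<|w| i<|drop|)) (sym (at-drop d w i)))
  periodic-drop : Periodic d (drop d w)
  periodic-drop i d+i<|drop| =
    trans (at-drop d w i) (trans (periodic (d +ℕ i) (d+<|w| d+i<|drop|)) (sym (at-drop d w (d +ℕ i))))

coeff-Pw : ∀ w i → coeff (Pw w) i ≡ ℤ.+ at w i / 1
coeff-Pw []      i       = refl
coeff-Pw (a ∷ w) zero    = refl
coeff-Pw (a ∷ w) (suc i) = coeff-Pw w i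

+/1-injective : ∀ {a b} → ℤ.+ a / 1 ≡ ℤ.+ b / 1 → a ≡ b
+/1-injective {a} {b} eq with ℚₚ./-injective-≃ (mkℚᵘ (ℤ.+ a) 0) (mkℚᵘ (ℤ.+ b) 0) eq
... | *≡* a*1≡b*1 = ℤₚ.+-injective (ℤₚ.*-cancelʳ-≡ (ℤ.+ a) (ℤ.+ b) (ℤ.+ 1) a*1≡b*1)

1<quotient : ∀ {d n} k → d < n → n ≡ k *ℕ d → 1 < k
1<quotient             zero          d<0   refl = contradiction d<0 ℕₚ.n≮0
1<quotient {d}         (suc zero)    d<d+0 refl = contradiction (subst (d <_) (ℕₚ.+-identityʳ d) d<d+0) (ℕₚ.n≮n d)
1<quotient             (suc (suc k)) _     _    = s≤s (s≤s z≤n)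

lemma1 : (w : Word) → PositiveLetters w → Primitive w →
         (d : ℕ) → 0 < d → d ∣ length w → d < length w →
         (g : Poly) → (g *ₚ XpowMinus1 d) ≈ₚ XpowMinus1 (length w) →
         ¬ (g ∣ₚ Pw w)
lemma1 w _ (_ , imprimitive) d _ (divides k n≡kd) d<n g g*Eᵈ≈Eⁿ (q , Pw≈g*q) =
  imprimitive (take d w , k , 1<quotient k d<n n≡kd ,
               periodic⇒≡^ʷ k w (length-take-≤ w (ℕₚ.<⇒≤ d<n)) (λ i i<d _ → at-take d w i<d) n≡kd periodic)
  where
  n = length w
  Eᵈ*Pw≈Eⁿ*q : (XpowMinus1 d *ₚ Pw w) ≈ₚ (XpowMinus1 n *ₚ q)
  Eᵈ*Pw≈Eⁿ*q i = begin
    coeff (XpowMinus1 d *ₚ Pw w) i              ≡⟨ *ₚ-congˡ (XpowMinus1 d) Pw≈g*q i ⟩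
    coeff (XpowMinus1 d *ₚ (g *ₚ q)) i          ≡⟨ *ₚ-assoc (XpowMinus1 d) g q i ⟨
    coeff ((XpowMinus1 d *ₚ g) *ₚ q) i          ≡⟨ *ₚ-congʳ {XpowMinus1 d *ₚ g} {g *ₚ XpowMinus1 d} q (*ₚ-comm (XpowMinus1 d) g) i ⟩
    coeff ((g *ₚ XpowMinus1 d) *ₚ q) i          ≡⟨ *ₚ-congʳ {g *ₚ XpowMinus1 d} {XpowMinus1 n} q g*Eᵈ≈Eⁿ i ⟩
    coeff (XpowMinus1 n *ₚ q) i                 ∎
  periodic : Periodic d w
  periodic i d+i<n = +/1-injective (begin
    ℤ.+ at w i / 1            ≡⟨ coeff-Pw w i ⟨
    coeff (Pw w) i            ≡⟨ coeff-periodic (ℕₚ.≤-reflexive (Listₚ.length-map (λ a → ℤ.+ a / 1) w)) Eᵈ*Pw≈Eⁿ*q i d+i<n ⟩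
    coeff (Pw w) (d +ℕ i)     ≡⟨ coeff-Pw w (d +ℕ i) ⟩
    ℤ.+ at w (d +ℕ i) / 1     ∎)
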